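{- For every positive integer $m$, $$A_{2m}^+(s,t)=s A_{2m-1}^+(s,t)+tA_{2m-1}^-(s,t)+\tfrac12 st\,D A_{2m-1}(s,t),$$ $$A_{2m}^-(s,t)=s A_{2m-1}^-(s,t)+tA_{2m-1}^+(s,t)+\tfrac12 st\,D A_{2m-1}(s,t),$$ where $D=\frac{\partial}{\partial s}+\frac{\partial}{\partial t}$.
   Context: For a permutation $\pi=\pi_1\cdots\pi_n$ of $[n]$ let $\mathsf{des}(\pi)=|\{i\in[n-1]:\pi_i>\pi_{i+1}\}|$ and $\mathsf{asc}(\pi)=n-1-\mathsf{des}(\pi)$. Let $\mathfrak{S}_n$ be the symmetric group and $\mathcal{A}_n$ the alternating group. $A_n(s,t)=\sum_{\pi\in\mathfrak{S}_n}t^{\mathsf{des}(\pi)}s^{\mathsf{asc}(\pi)}$, $A_n^+(s,t)=\sum_{\pi\in\mathcal{A}_n}t^{\mathsf{des}(\pi)}s^{\mathsf{asc}(\pi)}$ and $A_n^-(s,t)=\sum_{\pi\in\mathfrak{S}_n\setminus\mathcal{A}_n}t^{\mathsf{des}(\pi)}s^{\mathsf{asc}(\pi)}$. -}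

module Defs where

open import Data.Nat using (ℕ; zero; suc; _+_; _*_; _<ᵇ_; _≡ᵇ_; _%_)
open import Data.Bool using (Bool; true; false; if_then_else_; _∧_; not)
open import Data.List using (List; []; _∷_; map; concatMap; length; filter)
open import Data.Nat using (_<?_)
open import Relation.Binary.PropositionalEquality using (_≡_)
open import Data.Bool using (T?)

-- Permutations of [n] = {1,…,n} in one-line notation, as lists of ℕ.

insertions : ℕ → List ℕ → List (List ℕ)
insertions x []       = (x ∷ []) ∷ []
insertions x (y ∷ ys) = (x ∷ y ∷ ys) ∷ map (y ∷_) (insertions x ys)

perms : ℕ → List (List ℕ)
perms zero    = [] ∷ []
perms (suc n) = concatMap (insertions (suc n)) (perms n)

des : List ℕ → ℕ
des []           = 0
des (x ∷ [])     = 0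
des (x ∷ y ∷ ys) = (if y <ᵇ x then 1 else 0) + des (y ∷ ys)

asc : List ℕ → ℕ
asc []           = 0
asc (x ∷ [])     = 0
asc (x ∷ y ∷ ys) = (if x <ᵇ y then 1 else 0) + asc (y ∷ ys)

inv : List ℕ → ℕ
inv []       = 0
inv (x ∷ xs) = length (filter (λ y → y <? x) xs) + inv xs

isEven : List ℕ → Bool
isEven π = inv π % 2 ≡ᵇ 0

-- Bivariate polynomials in s,t with ℕ coefficients, represented by
-- their coefficient function: P i j = coefficient of s^i t^j.

Poly : Set
Poly = ℕ → ℕ → ℕ

_⊕_ : Poly → Poly → Poly
(P ⊕ Q) i j = P i j + Q i j
infixl 6 _⊕_

_⊛_ : ℕ → Poly → Poly
(c ⊛ P) i j = c * P i j
infixl 7 _⊛_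

s· : Poly → Poly
s· P zero    j = 0
s· P (suc i) j = P i j

t· : Poly → Poly
t· P i zero    = 0
t· P i (suc j) = P i j

∂s : Poly → Poly
∂s P i j = suc i * P (suc i) j

∂t : Poly → Poly
∂t P i j = suc j * P i (suc j)

D : Poly → Poly
D P = ∂s P ⊕ ∂t P

_≈P_ : Poly → Poly → Set
P ≈P Q = ∀ i j → P i j ≡ Q i j
infix 4 _≈P_

count : (List ℕ → Bool) → ℕ → Poly
count keep n i j =
  length (filter (λ π → T? (keep π ∧ (asc π ≡ᵇ i) ∧ (des π ≡ᵇ j))) (perms n))

A : ℕ → Poly
A = count (λ _ → true)

A⁺ : ℕ → Poly
A⁺ = count isEven

A⁻ : ℕ → Poly
A⁻ = count (λ π → not (isEven π))

-- Every permutation of [2m] arises exactly once by inserting N = 2m into a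
-- permutation σ of [2m-1]; placed in front of r entries, N adds r inversions.
-- At the front it adds a descent and, 2m-1 being odd, flips the sign: this gives
-- t A^∓_{2m-1}.  At the end it adds an ascent and keeps the sign: s A^±_{2m-1}.
-- Between adjacent entries a, b it adds an ascent if a > b and a descent if
-- a < b, so over both signs the interior insertions give s t D A_{2m-1}, σ having
-- asc σ ascent slots and des σ descent slots.  Reverse-complementation preserves
-- asc, des and inv and turns a slot followed by r entries into one followed by
-- 2m-1-r entries, so each sign receives exactly half of s t D A_{2m-1}.

module Submission where

open import Defs
open import Data.Bool using (Bool; true; false; if_then_else_; _∧_; not; T; T?)
open import Data.Bool.Properties using (T-≡; ∧-zeroʳ)
open import Data.List using (List; []; _∷_; map; concatMap; length; filter; _++_; reverse; _ʳ++_)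
open import Data.List.Properties using (map-++; map-∘; map-id; ʳ++-ʳ++; ʳ++-defn; ++-identityʳ; reverse-involutive; length-map; length-ʳ++)
open import Data.List.Relation.Unary.All as All using (All; []; _∷_)
open import Data.List.Relation.Unary.All.Properties using (map⁺; concat⁺)
open import Data.List.Relation.Unary.Linked as Linked using (Linked; []; [-]; _∷_)
open import Data.Nat using (ℕ; zero; suc; _+_; _*_; _∸_; _≤_; _<_; _<ᵇ_; _≡ᵇ_; _%_; s≤s; _<?_; parity)
open import Data.Nat.ListAction using (sum)
open import Data.Nat.ListAction.Properties using (sum-++)
open import Data.Nat.Properties
open import Data.Nat.Tactic.RingSolver using (solve-∀)
open import Algebra.Properties.CommutativeSemigroup +-commutativeSemigroup using () renaming (interchange to +-interchange)
open import Data.Parity.Base using (Parity; 0ℙ; 1ℙ; _⁻¹) renaming (_+_ to _+ℙ_)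
open import Data.Parity.Properties using (+-homo-+; suc-homo-⁻¹; *-homo-*) renaming (_≟_ to _≟ℙ_)
open import Data.Product using (_×_; _,_; proj₁; proj₂; swap)
open import Function using (_∘_; flip)
open import Function.Bundles using (Equivalence)
open import Relation.Binary.Definitions using (tri<; tri≈; tri>)
open import Relation.Binary.PropositionalEquality
open import Relation.Nullary using (does; yes; no; contradiction)
open import Relation.Unary using (Decidable)
open ≡-Reasoning

private variable X Y : Set

-- Sums over lists

𝟙 : Bool → ℕ
𝟙 b = if b then 1 else 0

Σ : (X → ℕ) → List X → ℕ
Σ f xs = sum (map f xs)

Σ-++ : (f : X → ℕ) (xs ys : List X) → Σ f (xs ++ ys) ≡ Σ f xs + Σ f ys
Σ-++ f xs ys = trans (cong sum (map-++ f xs ys)) (sum-++ (map f xs) (map f ys))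

Σ-concatMap : (f : Y → ℕ) (g : X → List Y) (xs : List X) →
              Σ f (concatMap g xs) ≡ Σ (Σ f ∘ g) xs
Σ-concatMap f g []       = refl
Σ-concatMap f g (x ∷ xs) = trans (Σ-++ f (g x) (concatMap g xs)) (cong (Σ f (g x) +_) (Σ-concatMap f g xs))

Σ-map : (f : Y → ℕ) (g : X → Y) (xs : List X) → Σ f (map g xs) ≡ Σ (f ∘ g) xs
Σ-map f g xs = cong sum (sym (map-∘ xs))

Σ-cong-All : {P : X → Set} {f g : X → ℕ} → (∀ x → P x → f x ≡ g x) → ∀ {xs} → All P xs → Σ f xs ≡ Σ g xs
Σ-cong-All f≡g         []         = refl
Σ-cong-All f≡g {x ∷ _} (px ∷ pxs) = cong₂ _+_ (f≡g x px) (Σ-cong-All f≡g pxs)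

Σ-cong : {f g : X → ℕ} → (∀ x → f x ≡ g x) → ∀ xs → Σ f xs ≡ Σ g xs
Σ-cong f≡g []       = refl
Σ-cong f≡g (x ∷ xs) = cong₂ _+_ (f≡g x) (Σ-cong f≡g xs)

Σ-+ : (f g : X → ℕ) (xs : List X) → Σ (λ x → f x + g x) xs ≡ Σ f xs + Σ g xs
Σ-+ f g []       = refl
Σ-+ f g (x ∷ xs) = trans (cong (f x + g x +_) (Σ-+ f g xs)) (+-interchange (f x) (g x) (Σ f xs) (Σ g xs))

Σ-*ˡ : (c : ℕ) (f : X → ℕ) (xs : List X) → Σ (λ x → c * f x) xs ≡ c * Σ f xs
Σ-*ˡ c f []       = sym (*-zeroʳ c)
Σ-*ˡ c f (x ∷ xs) = trans (cong (c * f x +_) (Σ-*ˡ c f xs)) (sym (*-distribˡ-+ c (f x) (Σ f xs)))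

Σ-zero : (xs : List X) → Σ (λ _ → 0) xs ≡ 0
Σ-zero []       = refl
Σ-zero (x ∷ xs) = Σ-zero xs

length-filter≡Σ : {P : X → Set} (P? : Decidable P) (xs : List X) → length (filter P? xs) ≡ Σ (𝟙 ∘ does ∘ P?) xs
length-filter≡Σ P? []       = refl
length-filter≡Σ P? (x ∷ xs) with does (P? x)
... | true  = cong suc (length-filter≡Σ P? xs)
... | false = length-filter≡Σ P? xs

-- Splits of a list

Split : Set
Split = List ℕ × List ℕ

-- The splits of L ʳ++ R from (L , R) onwards; prefixes are stored reversed.
splitsFrom : List ℕ → List ℕ → List Split
splitsFrom L []      = (L , []) ∷ []
splitsFrom L (x ∷ R) = (L , x ∷ R) ∷ splitsFrom (x ∷ L) R

splits : List ℕ → List Split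
splits = splitsFrom []

plug : ℕ → Split → List ℕ
plug N (L , R) = L ʳ++ (N ∷ R)

map-ʳ++-insertions : ∀ N L R → map (L ʳ++_) (insertions N R) ≡ map (plug N) (splitsFrom L R)
map-ʳ++-insertions N L []      = refl
map-ʳ++-insertions N L (x ∷ R) = cong ((L ʳ++ (N ∷ x ∷ R)) ∷_) (begin
  map (L ʳ++_) (map (x ∷_) (insertions N R)) ≡⟨ map-∘ (insertions N R) ⟨
  map ((x ∷ L) ʳ++_) (insertions N R)        ≡⟨ map-ʳ++-insertions N (x ∷ L) R ⟩
  map (plug N) (splitsFrom (x ∷ L) R)        ∎)

insertions≡map-plug : ∀ N σ → insertions N σ ≡ map (plug N) (splits σ)
insertions≡map-plug N σ = trans (sym (map-id (insertions N σ))) (map-ʳ++-insertions N [] σ)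

splitsFrom-ʳ++ : ∀ L R → All (λ z → proj₁ z ʳ++ proj₂ z ≡ L ʳ++ R) (splitsFrom L R)
splitsFrom-ʳ++ L []      = refl ∷ []
splitsFrom-ʳ++ L (x ∷ R) = refl ∷ splitsFrom-ʳ++ (x ∷ L) R

splits-ʳ++ : ∀ σ → All (λ z → proj₁ z ʳ++ proj₂ z ≡ σ) (splits σ)
splits-ʳ++ = splitsFrom-ʳ++ []

Σ-splits-reverse : (F : Split → ℕ) (ρ : List ℕ) → Σ F (splits ρ) ≡ Σ (F ∘ swap) (splits (reverse ρ))
Σ-splits-reverse F ρ = begin
  Σ F (splits ρ)                                  ≡⟨ unfold [] ρ ⟩
  F ([] , ρ) + after [] ρ                         ≡⟨ cong (_+ after [] ρ) (+-identityʳ _) ⟨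
  total [] ρ                                      ≡⟨ moveAll ρ [] ⟨
  Σ (F ∘ swap) (splits (reverse ρ)) + 0           ≡⟨ +-identityʳ _ ⟩
  Σ (F ∘ swap) (splits (reverse ρ))               ∎
  where
  after : List ℕ → List ℕ → ℕ
  after L []      = 0
  after L (x ∷ R) = Σ F (splitsFrom (x ∷ L) R)
  -- constant as the cursor (L , R) moves right
  total : List ℕ → List ℕ → ℕ
  total L R = Σ (F ∘ swap) (splitsFrom R L) + after L R
  unfold : ∀ L R → Σ F (splitsFrom L R) ≡ F (L , R) + after L R
  unfold L []      = refl
  unfold L (x ∷ R) = refl
  move : ∀ L x R → total (x ∷ L) R ≡ total L (x ∷ R)
  move L x R = begin
    F (x ∷ L , R) + Σ (F ∘ swap) (splitsFrom (x ∷ R) L) + after (x ∷ L) R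
      ≡⟨ cong (_+ after (x ∷ L) R) (+-comm (F (x ∷ L , R)) _) ⟩
    Σ (F ∘ swap) (splitsFrom (x ∷ R) L) + F (x ∷ L , R) + after (x ∷ L) R
      ≡⟨ +-assoc (Σ (F ∘ swap) (splitsFrom (x ∷ R) L)) (F (x ∷ L , R)) _ ⟩
    Σ (F ∘ swap) (splitsFrom (x ∷ R) L) + (F (x ∷ L , R) + after (x ∷ L) R)
      ≡⟨ cong (Σ (F ∘ swap) (splitsFrom (x ∷ R) L) +_) (unfold (x ∷ L) R) ⟨
    total L (x ∷ R) ∎
  moveAll : ∀ R L → total (R ʳ++ L) [] ≡ total L R
  moveAll []      L = refl
  moveAll (x ∷ R) L = trans (moveAll R (x ∷ L)) (move L x R)

interior : (ℕ → List ℕ → ℕ → List ℕ → ℕ) → Split → ℕ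
interior G (a ∷ L , b ∷ R) = G a L b R
interior G _               = 0

Σ-splitsFrom-last : ∀ (F : Split → ℕ) a L R →
  Σ F (splitsFrom (a ∷ L) R) ≡ Σ (interior (λ a L b R → F (a ∷ L , b ∷ R))) (splitsFrom (a ∷ L) R) + F (R ʳ++ (a ∷ L) , [])
Σ-splitsFrom-last F a L []      = +-identityʳ (F (a ∷ L , []))
Σ-splitsFrom-last F a L (x ∷ R) =
  trans (cong (F (a ∷ L , x ∷ R) +_) (Σ-splitsFrom-last F x (a ∷ L) R)) (sym (+-assoc (F (a ∷ L , x ∷ R)) _ _))

Σ-splits-ends : ∀ (F : Split → ℕ) x σ →
  Σ F (splits (x ∷ σ)) ≡ F ([] , x ∷ σ) + (Σ (interior (λ a L b R → F (a ∷ L , b ∷ R))) (splits (x ∷ σ)) + F (reverse (x ∷ σ) , []))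
Σ-splits-ends F x σ = cong (F ([] , x ∷ σ) +_) (Σ-splitsFrom-last F x [] σ)

mapSplit : (ℕ → ℕ) → Split → Split
mapSplit f (L , R) = map f L , map f R

Σ-splitsFrom-map : ∀ (F : Split → ℕ) f L R → Σ F (splitsFrom (map f L) (map f R)) ≡ Σ (F ∘ mapSplit f) (splitsFrom L R)
Σ-splitsFrom-map F f L []      = refl
Σ-splitsFrom-map F f L (x ∷ R) = cong (F (map f L , map f (x ∷ R)) +_) (Σ-splitsFrom-map F f (x ∷ L) R)

Σ-splits-map : ∀ (F : Split → ℕ) f σ → Σ F (splits (map f σ)) ≡ Σ (F ∘ mapSplit f) (splits σ)
Σ-splits-map F f = Σ-splitsFrom-map F f []

Linked-ʳ++⁻ : ∀ {_~_ : ℕ → ℕ → Set} xs {ys} → Linked _~_ (xs ʳ++ ys) → Linked _~_ ys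
Linked-ʳ++⁻ []       linked = linked
Linked-ʳ++⁻ (x ∷ xs) linked = Linked.tail (Linked-ʳ++⁻ xs linked)

All-ʳ++⁻ : ∀ {P : ℕ → Set} xs {ys} → All P (xs ʳ++ ys) → All P xs × All P ys
All-ʳ++⁻ []       all = [] , all
All-ʳ++⁻ (x ∷ xs) all with All-ʳ++⁻ xs all
... | pxs , (px ∷ pys) = (px ∷ pxs) , pys

plug-end : ∀ N σ → plug N (reverse σ , []) ≡ σ ++ N ∷ []
plug-end N σ = trans (ʳ++-defn (reverse σ)) (cong (_++ N ∷ []) (reverse-involutive σ))

-- Symmetries of the enumeration of permutations

Σ-insertions : ∀ (w : List ℕ → ℕ) N σ → Σ w (insertions N σ) ≡ Σ (w ∘ plug N) (splits σ)
Σ-insertions w N σ = trans (cong (Σ w) (insertions≡map-plug N σ)) (Σ-map w (plug N) (splits σ))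

Σ-perms-suc : ∀ (w : List ℕ → ℕ) n → Σ w (perms (suc n)) ≡ Σ (Σ w ∘ insertions (suc n)) (perms n)
Σ-perms-suc w n = Σ-concatMap w (insertions (suc n)) (perms n)

reverse-plug : ∀ N z → reverse (plug N z) ≡ plug N (swap z)
reverse-plug N (L , R) = trans (ʳ++-ʳ++ L) (cong (λ xs → R ʳ++ (N ∷ xs)) (++-identityʳ L))

Σ-perms-reverse : ∀ n (w : List ℕ → ℕ) → Σ (w ∘ reverse) (perms n) ≡ Σ w (perms n)
Σ-perms-reverse zero    w = refl
Σ-perms-reverse (suc n) w = begin
  Σ (w ∘ reverse) (perms (suc n))                  ≡⟨ Σ-perms-suc (w ∘ reverse) n ⟩
  Σ (Σ (w ∘ reverse) ∘ insertions (suc n)) (perms n) ≡⟨ Σ-cong reversed (perms n) ⟩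
  Σ (Σ w ∘ insertions (suc n) ∘ reverse) (perms n) ≡⟨ Σ-perms-reverse n (Σ w ∘ insertions (suc n)) ⟩
  Σ (Σ w ∘ insertions (suc n)) (perms n)           ≡⟨ Σ-perms-suc w n ⟨
  Σ w (perms (suc n))                              ∎
  where
  reversed : ∀ σ → Σ (w ∘ reverse) (insertions (suc n) σ) ≡ Σ w (insertions (suc n) (reverse σ))
  reversed σ = begin
    Σ (w ∘ reverse) (insertions (suc n) σ)         ≡⟨ Σ-insertions (w ∘ reverse) (suc n) σ ⟩
    Σ (w ∘ reverse ∘ plug (suc n)) (splits σ)      ≡⟨ Σ-cong (cong w ∘ reverse-plug (suc n)) (splits σ) ⟩
    Σ (w ∘ plug (suc n) ∘ swap) (splits σ)         ≡⟨ Σ-splits-reverse (w ∘ plug (suc n) ∘ swap) σ ⟩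
    Σ (w ∘ plug (suc n)) (splits (reverse σ))      ≡⟨ Σ-insertions w (suc n) (reverse σ) ⟨
    Σ w (insertions (suc n) (reverse σ))           ∎

map-insertions : ∀ (f : ℕ → ℕ) x l → map (map f) (insertions x l) ≡ insertions (f x) (map f l)
map-insertions f x []       = refl
map-insertions f x (y ∷ ys) = cong ((f x ∷ f y ∷ map f ys) ∷_) (begin
  map (map f) (map (y ∷_) (insertions x ys))  ≡⟨ map-∘ (insertions x ys) ⟨
  map (map f ∘ (y ∷_)) (insertions x ys)      ≡⟨ map-∘ (insertions x ys) ⟩
  map (f y ∷_) (map (map f) (insertions x ys)) ≡⟨ cong (map (f y ∷_)) (map-insertions f x ys) ⟩
  map (f y ∷_) (insertions (f x) (map f ys))  ∎)

Σ-insertions-twice : ∀ a b y ys (w : List ℕ → ℕ) →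
  Σ (Σ w ∘ insertions b) (insertions a (y ∷ ys))
  ≡ w (b ∷ a ∷ y ∷ ys) + w (a ∷ b ∷ y ∷ ys)
    + (Σ (λ u → w (a ∷ y ∷ u)) (insertions b ys) + Σ (λ u → w (b ∷ y ∷ u)) (insertions a ys))
    + Σ (Σ (w ∘ (y ∷_)) ∘ insertions b) (insertions a ys)
Σ-insertions-twice a b y ys w = begin
  Σ w (insertions b (a ∷ y ∷ ys)) + Σ (Σ w ∘ insertions b) (map (y ∷_) (insertions a ys))
    ≡⟨ cong₂ _+_ (cong (w (b ∷ a ∷ y ∷ ys) +_) bothFirst) (Σ-map (Σ w ∘ insertions b) (y ∷_) (insertions a ys)) ⟩
  w (b ∷ a ∷ y ∷ ys) + (w (a ∷ b ∷ y ∷ ys) + P) + Σ (λ u → Σ w (insertions b (y ∷ u))) (insertions a ys)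
    ≡⟨ cong (w (b ∷ a ∷ y ∷ ys) + (w (a ∷ b ∷ y ∷ ys) + P) +_) bFirst ⟩
  w (b ∷ a ∷ y ∷ ys) + (w (a ∷ b ∷ y ∷ ys) + P) + (Q + rest)
    ≡⟨ regroup (w (b ∷ a ∷ y ∷ ys)) (w (a ∷ b ∷ y ∷ ys)) P Q rest ⟩
  w (b ∷ a ∷ y ∷ ys) + w (a ∷ b ∷ y ∷ ys) + (P + Q) + rest ∎
  where
  P = Σ (λ u → w (a ∷ y ∷ u)) (insertions b ys)
  Q = Σ (λ u → w (b ∷ y ∷ u)) (insertions a ys)
  rest = Σ (Σ (w ∘ (y ∷_)) ∘ insertions b) (insertions a ys)
  regroup : ∀ p q r s t → p + (q + r) + (s + t) ≡ p + q + (r + s) + t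
  regroup = solve-∀
  bothFirst : Σ w (map (a ∷_) (insertions b (y ∷ ys))) ≡ w (a ∷ b ∷ y ∷ ys) + P
  bothFirst = trans (Σ-map w (a ∷_) (insertions b (y ∷ ys)))
                    (cong (w (a ∷ b ∷ y ∷ ys) +_) (Σ-map (w ∘ (a ∷_)) (y ∷_) (insertions b ys)))
  bFirst : Σ (λ u → Σ w (insertions b (y ∷ u))) (insertions a ys) ≡ Q + rest
  bFirst = trans (Σ-cong (λ u → cong (w (b ∷ y ∷ u) +_) (Σ-map w (y ∷_) (insertions b u))) (insertions a ys))
                 (Σ-+ (λ u → w (b ∷ y ∷ u)) (Σ (w ∘ (y ∷_)) ∘ insertions b) (insertions a ys))

Σ-insertions-comm : ∀ a b l (w : List ℕ → ℕ) →
  Σ (Σ w ∘ insertions b) (insertions a l) ≡ Σ (Σ w ∘ insertions a) (insertions b l)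
Σ-insertions-comm a b []       w = cong (_+ 0) (x+[y+0]≡y+[x+0] (w (b ∷ a ∷ [])) (w (a ∷ b ∷ [])))
  where
  x+[y+0]≡y+[x+0] : ∀ x y → x + (y + 0) ≡ y + (x + 0)
  x+[y+0]≡y+[x+0] = solve-∀
Σ-insertions-comm a b (y ∷ ys) w = begin
  Σ (Σ w ∘ insertions b) (insertions a (y ∷ ys))
    ≡⟨ Σ-insertions-twice a b y ys w ⟩
  w (b ∷ a ∷ y ∷ ys) + w (a ∷ b ∷ y ∷ ys) + (P + Q) + Σ (Σ (w ∘ (y ∷_)) ∘ insertions b) (insertions a ys)
    ≡⟨ cong₂ _+_ (cong₂ _+_ (+-comm _ (w (a ∷ b ∷ y ∷ ys))) (+-comm P Q)) (Σ-insertions-comm a b ys (w ∘ (y ∷_))) ⟩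
  w (a ∷ b ∷ y ∷ ys) + w (b ∷ a ∷ y ∷ ys) + (Q + P) + Σ (Σ (w ∘ (y ∷_)) ∘ insertions a) (insertions b ys)
    ≡⟨ Σ-insertions-twice b a y ys w ⟨
  Σ (Σ w ∘ insertions a) (insertions b (y ∷ ys)) ∎
  where
  P = Σ (λ u → w (a ∷ y ∷ u)) (insertions b ys)
  Q = Σ (λ u → w (b ∷ y ∷ u)) (insertions a ys)

Σ-perms-insert-min : ∀ n (w : List ℕ → ℕ) → Σ (Σ w ∘ insertions 1 ∘ map suc) (perms n) ≡ Σ w (perms (suc n))
Σ-perms-insert-min zero    w = +-identityʳ _
Σ-perms-insert-min (suc n) w = begin
  Σ (Σ w ∘ insertions 1 ∘ map suc) (perms (suc n))
    ≡⟨ Σ-perms-suc (Σ w ∘ insertions 1 ∘ map suc) n ⟩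
  Σ (Σ (Σ w ∘ insertions 1 ∘ map suc) ∘ insertions (suc n)) (perms n)
    ≡⟨ Σ-cong maxFirst (perms n) ⟩
  Σ (Σ (Σ w ∘ insertions (suc (suc n))) ∘ insertions 1 ∘ map suc) (perms n)
    ≡⟨ Σ-perms-insert-min n (Σ w ∘ insertions (suc (suc n))) ⟩
  Σ (Σ w ∘ insertions (suc (suc n))) (perms (suc n))
    ≡⟨ Σ-perms-suc w (suc n) ⟨
  Σ w (perms (suc (suc n))) ∎
  where
  maxFirst : ∀ ρ → Σ (Σ w ∘ insertions 1 ∘ map suc) (insertions (suc n) ρ)
                   ≡ Σ (Σ w ∘ insertions (suc (suc n))) (insertions 1 (map suc ρ))
  maxFirst ρ = begin
    Σ (Σ w ∘ insertions 1 ∘ map suc) (insertions (suc n) ρ)    ≡⟨ Σ-map (Σ w ∘ insertions 1) (map suc) (insertions (suc n) ρ) ⟨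
    Σ (Σ w ∘ insertions 1) (map (map suc) (insertions (suc n) ρ)) ≡⟨ cong (Σ (Σ w ∘ insertions 1)) (map-insertions suc (suc n) ρ) ⟩
    Σ (Σ w ∘ insertions 1) (insertions (suc (suc n)) (map suc ρ)) ≡⟨ Σ-insertions-comm (suc (suc n)) 1 (map suc ρ) w ⟩
    Σ (Σ w ∘ insertions (suc (suc n))) (insertions 1 (map suc ρ)) ∎

All-perms : (P : ℕ → List ℕ → Set) → P 0 [] →
            (∀ {n σ} → P n σ → All (P (suc n)) (insertions (suc n) σ)) → ∀ n → All (P n) (perms n)
All-perms P P[] step zero    = P[] ∷ []
All-perms P P[] step (suc n) = concat⁺ (map⁺ (All.map step (All-perms P P[] step n)))

All-insertions : ∀ {P : ℕ → Set} {x} → P x → ∀ {σ} → All P σ → All (All P) (insertions x σ)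
All-insertions px []         = (px ∷ []) ∷ []
All-insertions px (py ∷ pys) = (px ∷ py ∷ pys) ∷ map⁺ (All.map (py ∷_) (All-insertions px pys))

length-insertions : ∀ x σ → All (λ τ → length τ ≡ suc (length σ)) (insertions x σ)
length-insertions x []       = refl ∷ []
length-insertions x (y ∷ ys) = refl ∷ map⁺ (All.map (cong suc) (length-insertions x ys))

Linked-∷-insertions : ∀ {x y ys} → y < x → All (_< x) ys → Linked _≢_ (y ∷ ys) →
                      All (λ τ → Linked _≢_ (y ∷ τ)) (insertions x ys)
Linked-∷-insertions y<x []           [-]           = (<⇒≢ y<x ∷ [-]) ∷ []
Linked-∷-insertions y<x (z<x ∷ zs<x) (y≢z ∷ z∷zs) =
  (<⇒≢ y<x ∷ >⇒≢ z<x ∷ z∷zs) ∷ map⁺ (All.map (y≢z ∷_) (Linked-∷-insertions z<x zs<x z∷zs))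

Linked-insertions : ∀ {x σ} → All (_< x) σ → Linked _≢_ σ → All (Linked _≢_) (insertions x σ)
Linked-insertions []           []  = [-] ∷ []
Linked-insertions (y<x ∷ ys<x) y∷ys = (>⇒≢ y<x ∷ y∷ys) ∷ map⁺ (Linked-∷-insertions y<x ys<x y∷ys)

IsPerm : ℕ → List ℕ → Set
IsPerm n σ = length σ ≡ n × All (_≤ n) σ × Linked _≢_ σ

perms-IsPerm : ∀ n → All (IsPerm n) (perms n)
perms-IsPerm = All-perms IsPerm (refl , [] , []) insert
  where
  insert : ∀ {n σ} → IsPerm n σ → All (IsPerm (suc n)) (insertions (suc n) σ)
  insert {n} {σ} (refl , σ≤n , linked) =
    All.zip (length-insertions (suc n) σ ,
             All.zip (All-insertions ≤-refl (All.map m≤n⇒m≤1+n σ≤n) , Linked-insertions (All.map s≤s σ≤n) linked))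

complement : ℕ → ℕ → ℕ
complement n x = suc n ∸ x

map-complement-suc : ∀ {n σ} → All (_≤ n) σ → map (complement (suc n)) σ ≡ map suc (map (complement n) σ)
map-complement-suc []         = refl
map-complement-suc (x≤n ∷ σ≤n) = cong₂ _∷_ (+-∸-assoc 1 (m≤n⇒m≤1+n x≤n)) (map-complement-suc σ≤n)

Σ-perms-complement : ∀ n (w : List ℕ → ℕ) → Σ (w ∘ map (complement n)) (perms n) ≡ Σ w (perms n)
Σ-perms-complement zero    w = refl
Σ-perms-complement (suc n) w = begin
  Σ (w ∘ map (complement (suc n))) (perms (suc n))
    ≡⟨ Σ-perms-suc (w ∘ map (complement (suc n))) n ⟩
  Σ (Σ (w ∘ map (complement (suc n))) ∘ insertions (suc n)) (perms n)
    ≡⟨ Σ-cong-All (λ σ (_ , σ≤n , _) → complemented σ≤n) (perms-IsPerm n) ⟩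
  Σ (Σ w ∘ insertions 1 ∘ map suc ∘ map (complement n)) (perms n)
    ≡⟨ Σ-perms-complement n (Σ w ∘ insertions 1 ∘ map suc) ⟩
  Σ (Σ w ∘ insertions 1 ∘ map suc) (perms n)
    ≡⟨ Σ-perms-insert-min n w ⟩
  Σ w (perms (suc n)) ∎
  where
  complemented : ∀ {σ} → All (_≤ n) σ →
    Σ (w ∘ map (complement (suc n))) (insertions (suc n) σ) ≡ Σ w (insertions 1 (map suc (map (complement n) σ)))
  complemented {σ} σ≤n = begin
    Σ (w ∘ map (complement (suc n))) (insertions (suc n) σ)
      ≡⟨ Σ-map w (map (complement (suc n))) (insertions (suc n) σ) ⟨
    Σ w (map (map (complement (suc n))) (insertions (suc n) σ))
      ≡⟨ cong (Σ w) (map-insertions (complement (suc n)) (suc n) σ) ⟩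
    Σ w (insertions (complement (suc n) (suc n)) (map (complement (suc n)) σ))
      ≡⟨ cong₂ (λ x τ → Σ w (insertions x τ)) (m+n∸n≡m 1 n) (map-complement-suc σ≤n) ⟩
    Σ w (insertions 1 (map suc (map (complement n) σ))) ∎

reverseComplement : ℕ → List ℕ → List ℕ
reverseComplement n = reverse ∘ map (complement n)

Σ-perms-reverseComplement : ∀ n (w : List ℕ → ℕ) → Σ (w ∘ reverseComplement n) (perms n) ≡ Σ w (perms n)
Σ-perms-reverseComplement n w = trans (Σ-perms-complement n (w ∘ reverse)) (Σ-perms-reverse n w)

-- Ascents and descents as sums over adjacent pairs

adjacentSum : (ℕ → ℕ → ℕ) → List ℕ → ℕ
adjacentSum p []           = 0
adjacentSum p (x ∷ [])     = 0
adjacentSum p (x ∷ y ∷ ys) = p x y + adjacentSum p (y ∷ ys)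

ascent : ℕ → ℕ → ℕ
ascent x y = 𝟙 (x <ᵇ y)

asc≡adjacentSum : ∀ σ → asc σ ≡ adjacentSum ascent σ
asc≡adjacentSum []           = refl
asc≡adjacentSum (x ∷ [])     = refl
asc≡adjacentSum (x ∷ y ∷ ys) = cong (ascent x y +_) (asc≡adjacentSum (y ∷ ys))

des≡adjacentSum : ∀ σ → des σ ≡ adjacentSum (flip ascent) σ
des≡adjacentSum []           = refl
des≡adjacentSum (x ∷ [])     = refl
des≡adjacentSum (x ∷ y ∷ ys) = cong (ascent y x +_) (des≡adjacentSum (y ∷ ys))

adjacentSum-ʳ++ : ∀ p xs y ys → adjacentSum p (xs ʳ++ (y ∷ ys)) ≡ adjacentSum (flip p) (y ∷ xs) + adjacentSum p (y ∷ ys)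
adjacentSum-ʳ++ p []       y ys = refl
adjacentSum-ʳ++ p (x ∷ xs) y ys = trans (adjacentSum-ʳ++ p xs x (y ∷ ys))
  (x+[y+z]≡y+x+z (adjacentSum (flip p) (x ∷ xs)) (p x y) (adjacentSum p (y ∷ ys)))
  where
  x+[y+z]≡y+x+z : ∀ a b c → a + (b + c) ≡ b + a + c
  x+[y+z]≡y+x+z = solve-∀

adjacentSum-reverse : ∀ p σ → adjacentSum p (reverse σ) ≡ adjacentSum (flip p) σ
adjacentSum-reverse p []       = refl
adjacentSum-reverse p (x ∷ xs) = trans (adjacentSum-ʳ++ p xs x []) (+-identityʳ _)

adjacentSum-map : ∀ p f σ → adjacentSum p (map f σ) ≡ adjacentSum (λ x y → p (f x) (f y)) σ
adjacentSum-map p f []           = refl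
adjacentSum-map p f (x ∷ [])     = refl
adjacentSum-map p f (x ∷ y ∷ ys) = cong (p (f x) (f y) +_) (adjacentSum-map p f (y ∷ ys))

adjacentSum-cong-All : ∀ {P : ℕ → Set} {p q : ℕ → ℕ → ℕ} → (∀ {x y} → P x → P y → p x y ≡ q x y) →
                       ∀ {σ} → All P σ → adjacentSum p σ ≡ adjacentSum q σ
adjacentSum-cong-All p≡q []               = refl
adjacentSum-cong-All p≡q (px ∷ [])        = refl
adjacentSum-cong-All p≡q (px ∷ py ∷ pys) = cong₂ _+_ (p≡q px py) (adjacentSum-cong-All p≡q (py ∷ pys))

<ᵇ-true : ∀ {x y} → x < y → (x <ᵇ y) ≡ true
<ᵇ-true x<y = Equivalence.to T-≡ (<⇒<ᵇ x<y)

<ᵇ-false : ∀ {x y} → y ≤ x → (x <ᵇ y) ≡ false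
<ᵇ-false {x} {y} y≤x with x <ᵇ y in eq
... | false = refl
... | true  = contradiction (<ᵇ⇒< x y (subst T (sym eq) _)) (≤⇒≯ y≤x)

complement-<ᵇ : ∀ {n x y} → x ≤ n → y ≤ n → (complement n y <ᵇ complement n x) ≡ (x <ᵇ y)
complement-<ᵇ {n} {x} {y} x≤n y≤n with x <? y
... | yes x<y = trans (<ᵇ-true (∸-monoʳ-< x<y (m≤n⇒m≤1+n y≤n))) (sym (<ᵇ-true x<y))
... | no  x≮y = trans (<ᵇ-false (∸-monoʳ-≤ (suc n) (≮⇒≥ x≮y))) (sym (<ᵇ-false (≮⇒≥ x≮y)))

asc-reverseComplement : ∀ {n σ} → All (_≤ n) σ → asc (reverseComplement n σ) ≡ asc σ
asc-reverseComplement {n} {σ} σ≤n = begin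
  asc (reverse (map (complement n) σ))
    ≡⟨ asc≡adjacentSum (reverse (map (complement n) σ)) ⟩
  adjacentSum ascent (reverse (map (complement n) σ))
    ≡⟨ adjacentSum-reverse ascent (map (complement n) σ) ⟩
  adjacentSum (flip ascent) (map (complement n) σ)
    ≡⟨ adjacentSum-map (flip ascent) (complement n) σ ⟩
  adjacentSum (λ x y → ascent (complement n y) (complement n x)) σ
    ≡⟨ adjacentSum-cong-All (λ x≤n y≤n → cong 𝟙 (complement-<ᵇ x≤n y≤n)) σ≤n ⟩
  adjacentSum ascent σ
    ≡⟨ asc≡adjacentSum σ ⟨
  asc σ ∎

des-reverseComplement : ∀ {n σ} → All (_≤ n) σ → des (reverseComplement n σ) ≡ des σ
des-reverseComplement {n} {σ} σ≤n = begin
  des (reverse (map (complement n) σ))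
    ≡⟨ des≡adjacentSum (reverse (map (complement n) σ)) ⟩
  adjacentSum (flip ascent) (reverse (map (complement n) σ))
    ≡⟨ adjacentSum-reverse (flip ascent) (map (complement n) σ) ⟩
  adjacentSum ascent (map (complement n) σ)
    ≡⟨ adjacentSum-map ascent (complement n) σ ⟩
  adjacentSum (λ x y → ascent (complement n x) (complement n y)) σ
    ≡⟨ adjacentSum-cong-All (λ x≤n y≤n → cong 𝟙 (complement-<ᵇ y≤n x≤n)) σ≤n ⟩
  adjacentSum (flip ascent) σ
    ≡⟨ des≡adjacentSum σ ⟨
  des σ ∎

adjacentSum-plug : ∀ p N a L b R →
  adjacentSum p (plug N (a ∷ L , b ∷ R)) + p a b ≡ adjacentSum p ((a ∷ L) ʳ++ (b ∷ R)) + (p a N + p N b)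
adjacentSum-plug p N a L b R = begin
  adjacentSum p (L ʳ++ (a ∷ N ∷ b ∷ R)) + p a b
    ≡⟨ cong (_+ p a b) (adjacentSum-ʳ++ p L a (N ∷ b ∷ R)) ⟩
  adjacentSum (flip p) (a ∷ L) + (p a N + (p N b + adjacentSum p (b ∷ R))) + p a b
    ≡⟨ regroup (adjacentSum (flip p) (a ∷ L)) (p a N) (p N b) (adjacentSum p (b ∷ R)) (p a b) ⟩
  adjacentSum (flip p) (a ∷ L) + (p a b + adjacentSum p (b ∷ R)) + (p a N + p N b)
    ≡⟨ cong (_+ (p a N + p N b)) (adjacentSum-ʳ++ p L a (b ∷ R)) ⟨
  adjacentSum p (L ʳ++ (a ∷ b ∷ R)) + (p a N + p N b) ∎
  where
  regroup : ∀ f u v s x → f + (u + (v + s)) + x ≡ f + (x + s) + (u + v)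
  regroup = solve-∀

ascent-total : ∀ {a b} → a ≢ b → ascent a b + ascent b a ≡ 1
ascent-total {a} {b} a≢b with <-cmp a b
... | tri< a<b _ _ rewrite <ᵇ-true a<b | <ᵇ-false (<⇒≤ a<b) = refl
... | tri≈ _ a≡b _ = contradiction a≡b a≢b
... | tri> _ _ b<a rewrite <ᵇ-false (<⇒≤ b<a) | <ᵇ-true b<a = refl

module _ {N a b : ℕ} (a<N : a < N) (b<N : b < N) (a≢b : a ≢ b) (L R : List ℕ) where

  asc-plug : asc (plug N (a ∷ L , b ∷ R)) ≡ asc ((a ∷ L) ʳ++ (b ∷ R)) + ascent b a
  asc-plug = +-cancelʳ-≡ (ascent a b) _ _ (begin
    asc (plug N (a ∷ L , b ∷ R)) + ascent a b
      ≡⟨ cong (_+ ascent a b) (asc≡adjacentSum (plug N (a ∷ L , b ∷ R))) ⟩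
    adjacentSum ascent (plug N (a ∷ L , b ∷ R)) + ascent a b
      ≡⟨ adjacentSum-plug ascent N a L b R ⟩
    adjacentSum ascent ((a ∷ L) ʳ++ (b ∷ R)) + (ascent a N + ascent N b)
      ≡⟨ cong₂ (λ u v → adjacentSum ascent ((a ∷ L) ʳ++ (b ∷ R)) + (𝟙 u + 𝟙 v)) (<ᵇ-true a<N) (<ᵇ-false (<⇒≤ b<N)) ⟩
    adjacentSum ascent ((a ∷ L) ʳ++ (b ∷ R)) + 1
      ≡⟨ cong₂ _+_ (asc≡adjacentSum ((a ∷ L) ʳ++ (b ∷ R))) (ascent-total (≢-sym a≢b)) ⟨
    asc ((a ∷ L) ʳ++ (b ∷ R)) + (ascent b a + ascent a b)
      ≡⟨ +-assoc (asc ((a ∷ L) ʳ++ (b ∷ R))) (ascent b a) (ascent a b) ⟨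
    asc ((a ∷ L) ʳ++ (b ∷ R)) + ascent b a + ascent a b ∎)

  des-plug : des (plug N (a ∷ L , b ∷ R)) ≡ des ((a ∷ L) ʳ++ (b ∷ R)) + ascent a b
  des-plug = +-cancelʳ-≡ (ascent b a) _ _ (begin
    des (plug N (a ∷ L , b ∷ R)) + ascent b a
      ≡⟨ cong (_+ ascent b a) (des≡adjacentSum (plug N (a ∷ L , b ∷ R))) ⟩
    adjacentSum (flip ascent) (plug N (a ∷ L , b ∷ R)) + ascent b a
      ≡⟨ adjacentSum-plug (flip ascent) N a L b R ⟩
    adjacentSum (flip ascent) ((a ∷ L) ʳ++ (b ∷ R)) + (ascent N a + ascent b N)
      ≡⟨ cong₂ (λ u v → adjacentSum (flip ascent) ((a ∷ L) ʳ++ (b ∷ R)) + (𝟙 u + 𝟙 v)) (<ᵇ-false (<⇒≤ a<N)) (<ᵇ-true b<N) ⟩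
    adjacentSum (flip ascent) ((a ∷ L) ʳ++ (b ∷ R)) + 1
      ≡⟨ cong₂ _+_ (des≡adjacentSum ((a ∷ L) ʳ++ (b ∷ R))) (ascent-total a≢b) ⟨
    des ((a ∷ L) ʳ++ (b ∷ R)) + (ascent a b + ascent b a)
      ≡⟨ +-assoc (des ((a ∷ L) ʳ++ (b ∷ R))) (ascent a b) (ascent b a) ⟨
    des ((a ∷ L) ʳ++ (b ∷ R)) + ascent a b + ascent b a ∎)

module _ {N b : ℕ} (b<N : b < N) (R : List ℕ) where

  asc-cons-max : asc (N ∷ b ∷ R) ≡ asc (b ∷ R)
  asc-cons-max rewrite <ᵇ-false (<⇒≤ b<N) = refl

  des-cons-max : des (N ∷ b ∷ R) ≡ suc (des (b ∷ R))
  des-cons-max rewrite <ᵇ-true b<N = refl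

asc-++-max : ∀ {N a L} → All (_< N) (a ∷ L) → asc ((a ∷ L) ++ N ∷ []) ≡ suc (asc (a ∷ L))
asc-++-max {L = []}    (a<N ∷ [])    rewrite <ᵇ-true a<N = refl
asc-++-max {a = a} {L = b ∷ L} (_ ∷ bL<N) = trans (cong (ascent a b +_) (asc-++-max bL<N)) (+-suc (ascent a b) _)

des-++-max : ∀ {N a L} → All (_< N) (a ∷ L) → des ((a ∷ L) ++ N ∷ []) ≡ des (a ∷ L)
des-++-max {L = []}    (a<N ∷ [])    rewrite <ᵇ-false (<⇒≤ a<N) = refl
des-++-max {a = a} {L = b ∷ L} (_ ∷ bL<N) = cong (ascent b a +_) (des-++-max bL<N)

Σ-interior-splitsFrom : ∀ (p : ℕ → ℕ → ℕ) L x R →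
  Σ (interior (λ a _ b _ → p a b)) (splitsFrom (x ∷ L) R) ≡ adjacentSum p (x ∷ R)
Σ-interior-splitsFrom p L x []      = refl
Σ-interior-splitsFrom p L x (y ∷ R) = cong (p x y +_) (Σ-interior-splitsFrom p (x ∷ L) y R)

Σ-interior-splits : ∀ (p : ℕ → ℕ → ℕ) σ → Σ (interior (λ a _ b _ → p a b)) (splits σ) ≡ adjacentSum p σ
Σ-interior-splits p []      = refl
Σ-interior-splits p (x ∷ σ) = Σ-interior-splitsFrom p [] x σ

adjacentSum-cong-Linked : ∀ {_~_ : ℕ → ℕ → Set} {p q : ℕ → ℕ → ℕ} → (∀ {x y} → x ~ y → p x y ≡ q x y) →
                          ∀ {σ} → Linked _~_ σ → adjacentSum p σ ≡ adjacentSum q σ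
adjacentSum-cong-Linked p≡q []          = refl
adjacentSum-cong-Linked p≡q [-]         = refl
adjacentSum-cong-Linked p≡q (x~y ∷ y~ys) = cong₂ _+_ (p≡q x~y) (adjacentSum-cong-Linked p≡q y~ys)

adjacentSum-linear : ∀ u v p q σ → adjacentSum (λ x y → u * p x y + v * q x y) σ ≡ u * adjacentSum p σ + v * adjacentSum q σ
adjacentSum-linear u v p q []           = sym (cong₂ _+_ (*-zeroʳ u) (*-zeroʳ v))
adjacentSum-linear u v p q (x ∷ [])     = sym (cong₂ _+_ (*-zeroʳ u) (*-zeroʳ v))
adjacentSum-linear u v p q (x ∷ y ∷ ys) = trans (cong (u * p x y + v * q x y +_) (adjacentSum-linear u v p q (y ∷ ys)))
  (regroup u v (p x y) (q x y) (adjacentSum p (y ∷ ys)) (adjacentSum q (y ∷ ys)))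
  where
  regroup : ∀ u v a b s t → u * a + v * b + (u * s + v * t) ≡ u * (a + s) + v * (b + t)
  regroup = solve-∀

-- Inversions and sign

inv-∷ : ∀ x xs → inv (x ∷ xs) ≡ Σ (λ y → 𝟙 (y <ᵇ x)) xs + inv xs
inv-∷ x xs = cong (_+ inv xs) (length-filter≡Σ (_<? x) xs)

-- equals inv (reverse xs)
nonInversions : List ℕ → ℕ
nonInversions []       = 0
nonInversions (x ∷ xs) = Σ (λ y → 𝟙 (x <ᵇ y)) xs + nonInversions xs

crossInversions : List ℕ → List ℕ → ℕ
crossInversions xs ys = Σ (λ x → Σ (λ y → 𝟙 (y <ᵇ x)) ys) xs

inv-ʳ++ : ∀ xs ys → inv (xs ʳ++ ys) ≡ nonInversions xs + inv ys + crossInversions xs ys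
inv-ʳ++ []       ys = sym (+-identityʳ (inv ys))
inv-ʳ++ (x ∷ xs) ys = begin
  inv (xs ʳ++ (x ∷ ys))
    ≡⟨ inv-ʳ++ xs (x ∷ ys) ⟩
  nonInversions xs + inv (x ∷ ys) + crossInversions xs (x ∷ ys)
    ≡⟨ cong₂ (λ u v → nonInversions xs + u + v) (inv-∷ x ys)
             (Σ-+ (λ x′ → 𝟙 (x <ᵇ x′)) (λ x′ → Σ (λ y → 𝟙 (y <ᵇ x′)) ys) xs) ⟩
  nonInversions xs + (Σ (λ y → 𝟙 (y <ᵇ x)) ys + inv ys) + (Σ (λ x′ → 𝟙 (x <ᵇ x′)) xs + crossInversions xs ys)
    ≡⟨ regroup (nonInversions xs) (Σ (λ y → 𝟙 (y <ᵇ x)) ys) (inv ys) (Σ (λ x′ → 𝟙 (x <ᵇ x′)) xs) (crossInversions xs ys) ⟩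
  nonInversions (x ∷ xs) + inv ys + crossInversions (x ∷ xs) ys ∎
  where
  regroup : ∀ a c i d e → a + (c + i) + (d + e) ≡ d + a + i + (c + e)
  regroup = solve-∀

Σ-<ᵇ-above : ∀ {N} xs → All (_< N) xs → Σ (λ y → 𝟙 (y <ᵇ N)) xs ≡ length xs
Σ-<ᵇ-above []       []           = refl
Σ-<ᵇ-above (x ∷ xs) (x<N ∷ xs<N) = cong₂ (λ b s → 𝟙 b + s) (<ᵇ-true x<N) (Σ-<ᵇ-above xs xs<N)

Σ-<ᵇ-below : ∀ {N} xs → All (_< N) xs → Σ (λ x → 𝟙 (N <ᵇ x)) xs ≡ 0
Σ-<ᵇ-below []       []           = refl
Σ-<ᵇ-below (x ∷ xs) (x<N ∷ xs<N) = cong₂ (λ b s → 𝟙 b + s) (<ᵇ-false (<⇒≤ x<N)) (Σ-<ᵇ-below xs xs<N)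

inv-plug : ∀ {N} L R → All (_< N) L → All (_< N) R → inv (plug N (L , R)) ≡ inv (L ʳ++ R) + length R
inv-plug {N} L R L<N R<N = begin
  inv (L ʳ++ (N ∷ R))
    ≡⟨ inv-ʳ++ L (N ∷ R) ⟩
  nonInversions L + inv (N ∷ R) + crossInversions L (N ∷ R)
    ≡⟨ cong₂ (λ u v → nonInversions L + u + v)
             (trans (inv-∷ N R) (cong (_+ inv R) (Σ-<ᵇ-above R R<N)))
             (trans (Σ-+ (λ x → 𝟙 (N <ᵇ x)) (λ x → Σ (λ y → 𝟙 (y <ᵇ x)) R) L) (cong (_+ crossInversions L R) (Σ-<ᵇ-below L L<N))) ⟩
  nonInversions L + (length R + inv R) + (0 + crossInversions L R)
    ≡⟨ regroup (nonInversions L) (length R) (inv R) (crossInversions L R) ⟩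
  nonInversions L + inv R + crossInversions L R + length R
    ≡⟨ cong (_+ length R) (inv-ʳ++ L R) ⟨
  inv (L ʳ++ R) + length R ∎
  where
  regroup : ∀ a l i c → a + (l + i) + (0 + c) ≡ a + i + c + l
  regroup = solve-∀

inv-++-max : ∀ {N} σ → All (_< N) σ → inv (σ ++ N ∷ []) ≡ inv σ
inv-++-max         []       []           = refl
inv-++-max {N} (x ∷ xs) (x<N ∷ xs<N) = begin
  inv (x ∷ xs ++ N ∷ [])
    ≡⟨ inv-∷ x (xs ++ N ∷ []) ⟩
  Σ (λ y → 𝟙 (y <ᵇ x)) (xs ++ N ∷ []) + inv (xs ++ N ∷ [])
    ≡⟨ cong₂ _+_ (Σ-++ (λ y → 𝟙 (y <ᵇ x)) xs (N ∷ [])) (inv-++-max xs xs<N) ⟩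
  Σ (λ y → 𝟙 (y <ᵇ x)) xs + (𝟙 (N <ᵇ x) + 0) + inv xs
    ≡⟨ cong (λ b → Σ (λ y → 𝟙 (y <ᵇ x)) xs + (𝟙 b + 0) + inv xs) (<ᵇ-false (<⇒≤ x<N)) ⟩
  Σ (λ y → 𝟙 (y <ᵇ x)) xs + 0 + inv xs
    ≡⟨ cong (_+ inv xs) (+-identityʳ _) ⟩
  Σ (λ y → 𝟙 (y <ᵇ x)) xs + inv xs
    ≡⟨ inv-∷ x xs ⟨
  inv (x ∷ xs) ∎

nonInversions-complement : ∀ {n σ} → All (_≤ n) σ → nonInversions (map (complement n) σ) ≡ inv σ
nonInversions-complement {n} {[]}     []           = refl
nonInversions-complement {n} {x ∷ xs} (x≤n ∷ xs≤n) = begin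
  Σ (λ y → 𝟙 (complement n x <ᵇ y)) (map (complement n) xs) + nonInversions (map (complement n) xs)
    ≡⟨ cong₂ _+_ (trans (Σ-map (λ y → 𝟙 (complement n x <ᵇ y)) (complement n) xs)
                        (Σ-cong-All (λ y y≤n → cong 𝟙 (complement-<ᵇ y≤n x≤n)) xs≤n))
                 (nonInversions-complement xs≤n) ⟩
  Σ (λ y → 𝟙 (y <ᵇ x)) xs + inv xs
    ≡⟨ inv-∷ x xs ⟨
  inv (x ∷ xs) ∎

inv-reverseComplement : ∀ {n σ} → All (_≤ n) σ → inv (reverseComplement n σ) ≡ inv σ
inv-reverseComplement {n} {σ} σ≤n = begin
  inv (map (complement n) σ ʳ++ [])
    ≡⟨ inv-ʳ++ (map (complement n) σ) [] ⟩
  nonInversions (map (complement n) σ) + 0 + Σ (λ _ → 0) (map (complement n) σ)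
    ≡⟨ cong₂ _+_ (+-identityʳ _) (Σ-zero (map (complement n) σ)) ⟩
  nonInversions (map (complement n) σ) + 0
    ≡⟨ +-identityʳ _ ⟩
  nonInversions (map (complement n) σ)
    ≡⟨ nonInversions-complement σ≤n ⟩
  inv σ ∎

hasParity : Parity → ℕ → Bool
hasParity p m = does (parity m ≟ℙ p)

inParityClass : Parity → List ℕ → Bool
inParityClass 0ℙ = isEven
inParityClass 1ℙ = not ∘ isEven

%2≡ᵇ0≡hasParity0 : ∀ m → (m % 2 ≡ᵇ 0) ≡ hasParity 0ℙ m
%2≡ᵇ0≡hasParity0 zero          = refl
%2≡ᵇ0≡hasParity0 (suc zero)    = refl
%2≡ᵇ0≡hasParity0 (suc (suc m)) = %2≡ᵇ0≡hasParity0 m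

not-hasParity : ∀ p m → not (hasParity p m) ≡ hasParity (p ⁻¹) m
not-hasParity p m with parity m | p
... | 0ℙ | 0ℙ = refl
... | 0ℙ | 1ℙ = refl
... | 1ℙ | 0ℙ = refl
... | 1ℙ | 1ℙ = refl

inParityClass≡hasParity : ∀ p π → inParityClass p π ≡ hasParity p (inv π)
inParityClass≡hasParity 0ℙ π = %2≡ᵇ0≡hasParity0 (inv π)
inParityClass≡hasParity 1ℙ π = trans (cong not (%2≡ᵇ0≡hasParity0 (inv π))) (not-hasParity 0ℙ (inv π))

+ℙ-⁻¹ : ∀ p q → p +ℙ q ⁻¹ ≡ (p +ℙ q) ⁻¹
+ℙ-⁻¹ 0ℙ q = refl
+ℙ-⁻¹ 1ℙ q = refl

+ℙ≡1ℙ⇒≡⁻¹ : ∀ p q → p +ℙ q ≡ 1ℙ → p ≡ q ⁻¹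
+ℙ≡1ℙ⇒≡⁻¹ 0ℙ q p+q≡1 = cong _⁻¹ (sym p+q≡1)
+ℙ≡1ℙ⇒≡⁻¹ 1ℙ q p+q≡1 = sym p+q≡1

⁻¹-≟ℙ : ∀ q p → does (q ⁻¹ ≟ℙ p) ≡ does (q ≟ℙ p ⁻¹)
⁻¹-≟ℙ 0ℙ 0ℙ = refl
⁻¹-≟ℙ 0ℙ 1ℙ = refl
⁻¹-≟ℙ 1ℙ 0ℙ = refl
⁻¹-≟ℙ 1ℙ 1ℙ = refl

hasParity-shift : ∀ p m x y → parity (x + y) ≡ 1ℙ → hasParity p (m + x) ≡ hasParity (p ⁻¹) (m + y)
hasParity-shift p m x y x+y-odd = trans (cong (λ q → does (q ≟ℙ p)) flipped) (⁻¹-≟ℙ (parity (m + y)) p)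
  where
  flipped : parity (m + x) ≡ parity (m + y) ⁻¹
  flipped = begin
    parity (m + x)                   ≡⟨ +-homo-+ m x ⟩
    parity m +ℙ parity x             ≡⟨ cong (parity m +ℙ_) (+ℙ≡1ℙ⇒≡⁻¹ (parity x) (parity y) (trans (sym (+-homo-+ x y)) x+y-odd)) ⟩
    parity m +ℙ parity y ⁻¹          ≡⟨ +ℙ-⁻¹ (parity m) (parity y) ⟩
    (parity m +ℙ parity y) ⁻¹        ≡⟨ cong _⁻¹ (+-homo-+ m y) ⟨
    parity (m + y) ⁻¹                ∎

-- Coefficients of the Eulerian polynomials

hasStats : ℕ → ℕ → ℕ → ℕ → Bool
hasStats a d i j = (a ≡ᵇ i) ∧ (d ≡ᵇ j)

count≡Σ : ∀ keep n i j → count keep n i j ≡ Σ (λ π → 𝟙 (keep π ∧ hasStats (asc π) (des π) i j)) (perms n)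
count≡Σ keep n i j = length-filter≡Σ (λ π → T? (keep π ∧ hasStats (asc π) (des π) i j)) (perms n)

Σ-𝟙-false : {b : X → Bool} → (∀ x → b x ≡ false) → ∀ xs → Σ (𝟙 ∘ b) xs ≡ 0
Σ-𝟙-false b≡false xs = trans (Σ-cong (cong 𝟙 ∘ b≡false) xs) (Σ-zero xs)

hasStats-zeroʳ : ∀ a d i → hasStats a (suc d) i 0 ≡ false
hasStats-zeroʳ a d i = ∧-zeroʳ (a ≡ᵇ i)

s·-count : ∀ keep n i j → s· (count keep n) i j ≡ Σ (λ π → 𝟙 (keep π ∧ hasStats (suc (asc π)) (des π) i j)) (perms n)
s·-count keep n zero    j = sym (Σ-𝟙-false (λ π → ∧-zeroʳ (keep π)) (perms n))
s·-count keep n (suc i) j = count≡Σ keep n i j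

t·-count : ∀ keep n i j → t· (count keep n) i j ≡ Σ (λ π → 𝟙 (keep π ∧ hasStats (asc π) (suc (des π)) i j)) (perms n)
t·-count keep n i zero    = sym (Σ-𝟙-false (λ π → trans (cong (keep π ∧_) (hasStats-zeroʳ (asc π) (des π) i)) (∧-zeroʳ (keep π))) (perms n))
t·-count keep n i (suc j) = count≡Σ keep n i j

𝟙-hasStats-*ˡ : ∀ a d i j → 𝟙 (hasStats a d i j) * a ≡ 𝟙 (hasStats a d i j) * i
𝟙-hasStats-*ˡ a d i j with a ≡ᵇ i in a≡ᵇi
... | true  = cong (𝟙 (d ≡ᵇ j) *_) (≡ᵇ⇒≡ a i (subst T (sym a≡ᵇi) _))
... | false = refl

𝟙-hasStats-*ʳ : ∀ a d i j → 𝟙 (hasStats a d i j) * d ≡ 𝟙 (hasStats a d i j) * j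
𝟙-hasStats-*ʳ a d i j with a ≡ᵇ i | d ≡ᵇ j in d≡ᵇj
... | true  | true  = cong (1 *_) (≡ᵇ⇒≡ d j (subst T (sym d≡ᵇj) _))
... | true  | false = refl
... | false | _     = refl

stDA≡Σ : ∀ n i j → s· (t· (D (A n))) i j ≡
  Σ (λ σ → 𝟙 (hasStats (asc σ) (suc (des σ)) i j) * asc σ + 𝟙 (hasStats (suc (asc σ)) (des σ) i j) * des σ) (perms n)
stDA≡Σ n i j = begin
  s· (t· (D (A n))) i j
    ≡⟨ coefficient i j ⟩
  i * Σ X₁ (perms n) + j * Σ X₂ (perms n)
    ≡⟨ cong₂ _+_ (Σ-*ˡ i X₁ (perms n)) (Σ-*ˡ j X₂ (perms n)) ⟨
  Σ (λ σ → i * X₁ σ) (perms n) + Σ (λ σ → j * X₂ σ) (perms n)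
    ≡⟨ Σ-+ (λ σ → i * X₁ σ) (λ σ → j * X₂ σ) (perms n) ⟨
  Σ (λ σ → i * X₁ σ + j * X₂ σ) (perms n)
    ≡⟨ Σ-cong pointwise (perms n) ⟩
  Σ (λ σ → X₁ σ * asc σ + X₂ σ * des σ) (perms n) ∎
  where
  X₁ X₂ : List ℕ → ℕ
  X₁ σ = 𝟙 (hasStats (asc σ) (suc (des σ)) i j)
  X₂ σ = 𝟙 (hasStats (suc (asc σ)) (des σ) i j)
  pointwise : ∀ σ → i * X₁ σ + j * X₂ σ ≡ X₁ σ * asc σ + X₂ σ * des σ
  pointwise σ = cong₂ _+_ (trans (*-comm i (X₁ σ)) (sym (𝟙-hasStats-*ˡ (asc σ) (suc (des σ)) i j)))
                          (trans (*-comm j (X₂ σ)) (sym (𝟙-hasStats-*ʳ (suc (asc σ)) (des σ) i j)))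
  coefficient : ∀ i j → s· (t· (D (A n))) i j ≡ i * Σ (λ σ → 𝟙 (hasStats (asc σ) (suc (des σ)) i j)) (perms n)
                                               + j * Σ (λ σ → 𝟙 (hasStats (suc (asc σ)) (des σ) i j)) (perms n)
  coefficient zero    j       = sym (trans (cong (j *_) (Σ-zero (perms n))) (*-zeroʳ j))
  coefficient (suc i) zero    = sym (trans (+-identityʳ _) (trans (cong (suc i *_)
    (Σ-𝟙-false (λ σ → hasStats-zeroʳ (asc σ) (des σ) (suc i)) (perms n))) (*-zeroʳ (suc i))))
  coefficient (suc i) (suc j) = cong₂ _+_ (cong (suc i *_) (count≡Σ (λ _ → true) n (suc i) j)) (cong (suc j *_) (count≡Σ (λ _ → true) n i (suc j)))

𝟙-∧-not : ∀ h q → 𝟙 (h ∧ q) + 𝟙 (not h ∧ q) ≡ 𝟙 q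
𝟙-∧-not true  q = +-identityʳ (𝟙 q)
𝟙-∧-not false q = refl

𝟙-hasStats-ascent : ∀ {a b} → a ≢ b → ∀ x y i j →
  𝟙 (hasStats (x + ascent b a) (y + ascent a b) i j)
  ≡ 𝟙 (hasStats x (suc y) i j) * ascent a b + 𝟙 (hasStats (suc x) y i j) * ascent b a
𝟙-hasStats-ascent {a} {b} a≢b x y i j with <-cmp a b
... | tri< a<b _ _ rewrite <ᵇ-true a<b | <ᵇ-false (<⇒≤ a<b) | +-identityʳ x | +-comm y 1 =
  sym (trans (cong (𝟙 (hasStats x (suc y) i j) * 1 +_) (*-zeroʳ (𝟙 (hasStats (suc x) y i j)))) (trans (+-identityʳ _) (*-identityʳ _)))
... | tri≈ _ a≡b _ = contradiction a≡b a≢b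
... | tri> _ _ b<a rewrite <ᵇ-false (<⇒≤ b<a) | <ᵇ-true b<a | +-identityʳ y | +-comm x 1 =
  sym (trans (cong (_+ 𝟙 (hasStats (suc x) y i j) * 1) (*-zeroʳ (𝟙 (hasStats x (suc y) i j)))) (*-identityʳ _))

module InsertingTheMaximum (n : ℕ) (n-odd : parity n ≡ 1ℙ) (i j : ℕ) where

  N : ℕ
  N = suc n

  weight : Parity → List ℕ → ℕ
  weight p π = 𝟙 (inParityClass p π ∧ hasStats (asc π) (des π) i j)

  frontWeight endWeight : Parity → List ℕ → ℕ
  frontWeight p σ = 𝟙 (inParityClass p σ ∧ hasStats (asc σ) (suc (des σ)) i j)
  endWeight   p σ = 𝟙 (inParityClass p σ ∧ hasStats (suc (asc σ)) (des σ) i j)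

  -- N inserted between the adjacent entries a and b of σ, followed by b ∷ R
  slotWeight : Parity → List ℕ → ℕ → List ℕ → ℕ → List ℕ → ℕ
  slotWeight p σ a L b R = 𝟙 (hasParity p (inv σ + suc (length R)) ∧ hasStats (asc σ + ascent b a) (des σ + ascent a b) i j)

  interiorWeight : Parity → List ℕ → ℕ
  interiorWeight p σ = Σ (interior (slotWeight p σ)) (splits σ)

  below : ∀ {σ} → IsPerm n σ → All (_< N) σ
  below (_ , σ≤n , _) = All.map s≤s σ≤n

  weight-front : ∀ p b R → IsPerm n (b ∷ R) → weight p (N ∷ b ∷ R) ≡ frontWeight (p ⁻¹) (b ∷ R)
  weight-front p b R perm@(len , _) = cong₂ (λ h s → 𝟙 (h ∧ s)) parityFlips
    (cong₂ (λ a d → hasStats a d i j) (asc-cons-max b<N R) (des-cons-max b<N R))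
    where
    σ = b ∷ R
    b<N : b < N
    b<N = All.head (below perm)
    parityFlips : inParityClass p (N ∷ σ) ≡ inParityClass (p ⁻¹) σ
    parityFlips = begin
      inParityClass p (N ∷ σ)     ≡⟨ inParityClass≡hasParity p (N ∷ σ) ⟩
      hasParity p (inv (N ∷ σ))   ≡⟨ cong (hasParity p) (trans (inv-∷ N σ) (cong (_+ inv σ) (trans (Σ-<ᵇ-above σ (below perm)) len))) ⟩
      hasParity p (n + inv σ)     ≡⟨ cong (hasParity p) (+-comm n (inv σ)) ⟩
      hasParity p (inv σ + n)     ≡⟨ hasParity-shift p (inv σ) n 0 (trans (cong parity (+-identityʳ n)) n-odd) ⟩
      hasParity (p ⁻¹) (inv σ + 0) ≡⟨ cong (hasParity (p ⁻¹)) (+-identityʳ (inv σ)) ⟩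
      hasParity (p ⁻¹) (inv σ)    ≡⟨ inParityClass≡hasParity (p ⁻¹) σ ⟨
      inParityClass (p ⁻¹) σ      ∎

  weight-end : ∀ p a L → IsPerm n (a ∷ L) → weight p (a ∷ L ++ N ∷ []) ≡ endWeight p (a ∷ L)
  weight-end p a L perm = cong₂ (λ h s → 𝟙 (h ∧ s))
    (begin
      inParityClass p (σ ++ N ∷ [])   ≡⟨ inParityClass≡hasParity p (σ ++ N ∷ []) ⟩
      hasParity p (inv (σ ++ N ∷ [])) ≡⟨ cong (hasParity p) (inv-++-max σ (below perm)) ⟩
      hasParity p (inv σ)             ≡⟨ inParityClass≡hasParity p σ ⟨
      inParityClass p σ               ∎)
    (cong₂ (λ a d → hasStats a d i j) (asc-++-max (below perm)) (des-++-max (below perm)))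
    where σ = a ∷ L

  weight-slot : ∀ p {σ} a L b R → (a ∷ L) ʳ++ (b ∷ R) ≡ σ → IsPerm n σ →
                weight p (plug N (a ∷ L , b ∷ R)) ≡ slotWeight p σ a L b R
  weight-slot p a L b R refl perm@(_ , _ , linked) = cong₂ (λ h s → 𝟙 (h ∧ s))
    (trans (inParityClass≡hasParity p (plug N (a ∷ L , b ∷ R))) (cong (hasParity p) (inv-plug (a ∷ L) (b ∷ R) aL<N bR<N)))
    (cong₂ (λ u v → hasStats u v i j) (asc-plug a<N b<N a≢b L R) (des-plug a<N b<N a≢b L R))
    where
    aL<N = proj₁ (All-ʳ++⁻ (a ∷ L) (below perm))
    bR<N = proj₂ (All-ʳ++⁻ (a ∷ L) (below perm))
    a<N = All.head aL<N
    b<N = All.head bR<N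
    a≢b : a ≢ b
    a≢b = Linked.head (Linked-ʳ++⁻ L linked)

  Σ-weight-insertions : ∀ p σ → IsPerm n σ →
    Σ (weight p) (insertions N σ) ≡ frontWeight (p ⁻¹) σ + (interiorWeight p σ + endWeight p σ)
  Σ-weight-insertions p [] (len , _) = contradiction (trans (cong parity len) n-odd) λ ()
  Σ-weight-insertions p σ@(x ∷ σ′) perm = begin
    Σ (weight p) (insertions N σ)
      ≡⟨ Σ-insertions (weight p) N σ ⟩
    Σ (weight p ∘ plug N) (splits σ)
      ≡⟨ Σ-splits-ends (weight p ∘ plug N) x σ′ ⟩
    weight p (N ∷ σ) + (Σ (interior (λ a L b R → weight p (plug N (a ∷ L , b ∷ R)))) (splits σ) + weight p (plug N (reverse σ , [])))
      ≡⟨ cong₂ _+_ (weight-front p x σ′ perm)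
                   (cong₂ _+_ (Σ-cong-All slots (splits-ʳ++ σ))
                              (trans (cong (weight p) (plug-end N σ)) (weight-end p x σ′ perm))) ⟩
    frontWeight (p ⁻¹) σ + (interiorWeight p σ + endWeight p σ) ∎
    where
    slots : ∀ z → proj₁ z ʳ++ proj₂ z ≡ σ →
            interior (λ a L b R → weight p (plug N (a ∷ L , b ∷ R))) z ≡ interior (slotWeight p σ) z
    slots (a ∷ L , b ∷ R) split = weight-slot p a L b R split perm
    slots ([]    , _)     _     = refl
    slots (_ ∷ _ , [])    _     = refl

  interiorWeight-reverseComplement : ∀ p σ → IsPerm n σ → interiorWeight p (reverseComplement n σ) ≡ interiorWeight (p ⁻¹) σ
  interiorWeight-reverseComplement p σ perm@(len , σ≤n , _) = begin
    Σ (interior (slotWeight p σᶜ)) (splits (reverse (map (complement n) σ)))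
      ≡⟨ Σ-splits-reverse (interior (slotWeight p σᶜ) ∘ swap) (map (complement n) σ) ⟨
    Σ (interior (slotWeight p σᶜ) ∘ swap) (splits (map (complement n) σ))
      ≡⟨ Σ-splits-map (interior (slotWeight p σᶜ) ∘ swap) (complement n) σ ⟩
    Σ (interior (slotWeight p σᶜ) ∘ swap ∘ mapSplit (complement n)) (splits σ)
      ≡⟨ Σ-cong-All slots (splits-ʳ++ σ) ⟩
    Σ (interior (slotWeight (p ⁻¹) σ)) (splits σ) ∎
    where
    σᶜ = reverseComplement n σ
    slots : ∀ z → proj₁ z ʳ++ proj₂ z ≡ σ →
            interior (slotWeight p σᶜ) (swap (mapSplit (complement n) z)) ≡ interior (slotWeight (p ⁻¹) σ) z
    slots ([]    , [])    _     = refl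
    slots ([]    , _ ∷ _) _     = refl
    slots (_ ∷ _ , [])    _     = refl
    slots (a ∷ L , b ∷ R) refl  = cong₂ (λ h s → 𝟙 (h ∧ s)) parityFlips
      (cong₂ (λ u v → hasStats u v i j)
        (cong₂ _+_ (asc-reverseComplement σ≤n) (cong 𝟙 (complement-<ᵇ b≤n a≤n)))
        (cong₂ _+_ (des-reverseComplement σ≤n) (cong 𝟙 (complement-<ᵇ a≤n b≤n))))
      where
      a≤n = All.head (proj₁ (All-ʳ++⁻ (a ∷ L) σ≤n))
      b≤n = All.head (proj₂ (All-ʳ++⁻ (a ∷ L) σ≤n))
      lengths-odd : parity (suc (length L) + suc (length R)) ≡ 1ℙ
      lengths-odd = trans (cong parity (trans (sym (length-ʳ++ (a ∷ L))) len)) n-odd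
      parityFlips : hasParity p (inv σᶜ + suc (length (map (complement n) L))) ≡ hasParity (p ⁻¹) (inv σ + suc (length R))
      parityFlips = begin
        hasParity p (inv σᶜ + suc (length (map (complement n) L)))
          ≡⟨ cong₂ (λ u l → hasParity p (u + suc l)) (inv-reverseComplement σ≤n) (length-map (complement n) L) ⟩
        hasParity p (inv σ + suc (length L))
          ≡⟨ hasParity-shift p (inv σ) (suc (length L)) (suc (length R)) lengths-odd ⟩
        hasParity (p ⁻¹) (inv σ + suc (length R)) ∎

  interiorWeight-complementary : ∀ p σ → IsPerm n σ →
    interiorWeight p σ + interiorWeight (p ⁻¹) σ
    ≡ 𝟙 (hasStats (asc σ) (suc (des σ)) i j) * asc σ + 𝟙 (hasStats (suc (asc σ)) (des σ) i j) * des σ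
  interiorWeight-complementary p σ (_ , _ , linked) = begin
    interiorWeight p σ + interiorWeight (p ⁻¹) σ
      ≡⟨ Σ-+ (interior (slotWeight p σ)) (interior (slotWeight (p ⁻¹) σ)) (splits σ) ⟨
    Σ (λ z → interior (slotWeight p σ) z + interior (slotWeight (p ⁻¹) σ) z) (splits σ)
      ≡⟨ Σ-cong bothParities (splits σ) ⟩
    Σ (interior (λ a _ b _ → slot a b)) (splits σ)
      ≡⟨ Σ-interior-splits slot σ ⟩
    adjacentSum slot σ
      ≡⟨ adjacentSum-cong-Linked (λ a≢b → 𝟙-hasStats-ascent a≢b (asc σ) (des σ) i j) linked ⟩
    adjacentSum (λ a b → X₁ * ascent a b + X₂ * ascent b a) σ
      ≡⟨ adjacentSum-linear X₁ X₂ ascent (flip ascent) σ ⟩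
    X₁ * adjacentSum ascent σ + X₂ * adjacentSum (flip ascent) σ
      ≡⟨ cong₂ (λ u v → X₁ * u + X₂ * v) (asc≡adjacentSum σ) (des≡adjacentSum σ) ⟨
    X₁ * asc σ + X₂ * des σ ∎
    where
    X₁ = 𝟙 (hasStats (asc σ) (suc (des σ)) i j)
    X₂ = 𝟙 (hasStats (suc (asc σ)) (des σ) i j)
    slot : ℕ → ℕ → ℕ
    slot a b = 𝟙 (hasStats (asc σ + ascent b a) (des σ + ascent a b) i j)
    bothParities : ∀ z → interior (slotWeight p σ) z + interior (slotWeight (p ⁻¹) σ) z ≡ interior (λ a _ b _ → slot a b) z
    bothParities ([]    , _)     = refl
    bothParities (_ ∷ _ , [])    = refl
    bothParities (a ∷ L , b ∷ R) =
      trans (cong (λ h → 𝟙 (hasParity p m ∧ _) + 𝟙 (h ∧ _)) (sym (not-hasParity p m))) (𝟙-∧-not (hasParity p m) _)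
      where m = inv σ + suc (length R)

  count-insertMax : ∀ p → count (inParityClass p) N i j
    ≡ t· (count (inParityClass (p ⁻¹)) n) i j + (Σ (interiorWeight p) (perms n) + s· (count (inParityClass p) n) i j)
  count-insertMax p = begin
    count (inParityClass p) N i j
      ≡⟨ count≡Σ (inParityClass p) N i j ⟩
    Σ (weight p) (perms N)
      ≡⟨ Σ-perms-suc (weight p) n ⟩
    Σ (Σ (weight p) ∘ insertions N) (perms n)
      ≡⟨ Σ-cong-All (Σ-weight-insertions p) (perms-IsPerm n) ⟩
    Σ (λ σ → frontWeight (p ⁻¹) σ + (interiorWeight p σ + endWeight p σ)) (perms n)
      ≡⟨ Σ-+ (frontWeight (p ⁻¹)) _ (perms n) ⟩
    Σ (frontWeight (p ⁻¹)) (perms n) + Σ (λ σ → interiorWeight p σ + endWeight p σ) (perms n)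
      ≡⟨ cong₂ _+_ (sym (t·-count (inParityClass (p ⁻¹)) n i j)) (Σ-+ (interiorWeight p) (endWeight p) (perms n)) ⟩
    t· (count (inParityClass (p ⁻¹)) n) i j + (Σ (interiorWeight p) (perms n) + Σ (endWeight p) (perms n))
      ≡⟨ cong (λ e → t· (count (inParityClass (p ⁻¹)) n) i j + (Σ (interiorWeight p) (perms n) + e)) (s·-count (inParityClass p) n i j) ⟨
    t· (count (inParityClass (p ⁻¹)) n) i j + (Σ (interiorWeight p) (perms n) + s· (count (inParityClass p) n) i j) ∎

  Σ-interiorWeight-symmetric : ∀ p → Σ (interiorWeight p) (perms n) ≡ Σ (interiorWeight (p ⁻¹)) (perms n)
  Σ-interiorWeight-symmetric p = trans (sym (Σ-perms-reverseComplement n (interiorWeight p)))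
    (Σ-cong-All (interiorWeight-reverseComplement p) (perms-IsPerm n))

  Σ-interiorWeight-complementary : ∀ p → Σ (interiorWeight p) (perms n) + Σ (interiorWeight (p ⁻¹)) (perms n) ≡ s· (t· (D (A n))) i j
  Σ-interiorWeight-complementary p = begin
    Σ (interiorWeight p) (perms n) + Σ (interiorWeight (p ⁻¹)) (perms n)
      ≡⟨ Σ-+ (interiorWeight p) (interiorWeight (p ⁻¹)) (perms n) ⟨
    Σ (λ σ → interiorWeight p σ + interiorWeight (p ⁻¹) σ) (perms n)
      ≡⟨ Σ-cong-All (interiorWeight-complementary p) (perms-IsPerm n) ⟩
    Σ (λ σ → 𝟙 (hasStats (asc σ) (suc (des σ)) i j) * asc σ + 𝟙 (hasStats (suc (asc σ)) (des σ) i j) * des σ) (perms n)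
      ≡⟨ stDA≡Σ n i j ⟨
    s· (t· (D (A n))) i j ∎

  recurrence : ∀ p → 2 * count (inParityClass p) N i j
    ≡ 2 * s· (count (inParityClass p) n) i j + 2 * t· (count (inParityClass (p ⁻¹)) n) i j + s· (t· (D (A n))) i j
  recurrence p = begin
    2 * count (inParityClass p) N i j
      ≡⟨ cong (2 *_) (count-insertMax p) ⟩
    2 * (fronts + (interiors + ends))
      ≡⟨ regroup fronts interiors ends ⟩
    2 * ends + 2 * fronts + (interiors + interiors)
      ≡⟨ cong (λ interiors′ → 2 * ends + 2 * fronts + (interiors + interiors′)) (Σ-interiorWeight-symmetric p) ⟩
    2 * ends + 2 * fronts + (interiors + Σ (interiorWeight (p ⁻¹)) (perms n))
      ≡⟨ cong (2 * ends + 2 * fronts +_) (Σ-interiorWeight-complementary p) ⟩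
    2 * ends + 2 * fronts + s· (t· (D (A n))) i j ∎
    where
    ends = s· (count (inParityClass p) n) i j
    fronts = t· (count (inParityClass (p ⁻¹)) n) i j
    interiors = Σ (interiorWeight p) (perms n)
    regroup : ∀ t x s → 2 * (t + (x + s)) ≡ 2 * s + 2 * t + (x + x)
    regroup = solve-∀


theorem18 : (m : ℕ) → 1 ≤ m →
    (2 ⊛ A⁺ (2 * m) ≈P 2 ⊛ s· (A⁺ (2 * m ∸ 1)) ⊕ 2 ⊛ t· (A⁻ (2 * m ∸ 1)) ⊕ s· (t· (D (A (2 * m ∸ 1)))))
    × (2 ⊛ A⁻ (2 * m) ≈P 2 ⊛ s· (A⁻ (2 * m ∸ 1)) ⊕ 2 ⊛ t· (A⁺ (2 * m ∸ 1)) ⊕ s· (t· (D (A (2 * m ∸ 1)))))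
theorem18 m@(suc _) _ = (λ i j → InsertingTheMaximum.recurrence n n-odd i j 0ℙ)
                        , (λ i j → InsertingTheMaximum.recurrence n n-odd i j 1ℙ)
  where
  n = 2 * m ∸ 1
  n-odd : parity n ≡ 1ℙ
  n-odd = trans (sym (suc-homo-⁻¹ n)) (cong _⁻¹ (*-homo-* 2 m))
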